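{- Let $n,k,r,q$ be integers with $n\ge2k\ge2$, $q\ge1$ and $0\le r\le k-1$. Let $n_1,\ldots,n_t$ be positive integers with $n=\sum_{i=1}^t n_i$, and let $I_1,I_2,I_3\subseteq[t]$ be the sets of indices $i$ with $n_i<k$, with $k\le n_i<2k$, and with $n_i\ge 2k$, respectively. Then $$\chi_{qk-r}(K(n,k))\ge |I_2|\cdot(qk-r)+\sum_{i\in I_3}\Bigl(qn_i-\Bigl\lfloor\frac{n_ir}{k}\Bigr\rfloor\Bigr).$$
   Context: For integers $n\ge k\ge 1$, the Kneser graph $K(n,k)$ has as vertices all $k$-element subsets of $[n]=\{1,\dots,n\}$, two vertices being adjacent iff the subsets are disjoint. A graph $G$ is $(n,k)$-colourable if each vertex can be assigned a $k$-subset of $[n]$ so that adjacent vertices receive disjoint subsets. The $k$-th multi-chromatic number $\chi_k(G)$ is the smallest $n$ such that $G$ is $(n,k)$-colourable. -}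

module Defs where

open import Data.Nat using (ℕ; zero; suc; _+_; _*_; _∸_; _≤_; _<_; _<?_; NonZero)
open import Data.Nat.DivMod using (_/_)
open import Data.Fin using (Fin)
open import Data.Fin.Subset using (Subset; _∈_; ∣_∣)
open import Data.List using (List; []; _∷_)
open import Data.Product using (Σ; _×_)
open import Data.Empty using (⊥)
open import Relation.Nullary using (yes; no)
open import Relation.Binary.PropositionalEquality using (_≡_)

record Graph : Set₁ where
  field
    V   : Set
    Adj : V → V → Set
open Graph public

Disjoint : ∀ {n} → Subset n → Subset n → Set
Disjoint {n} s t = (x : Fin n) → x ∈ s → x ∈ t → ⊥

KSubset : ℕ → ℕ → Set
KSubset n k = Σ (Subset n) (λ s → ∣ s ∣ ≡ k)

Kneser : ℕ → ℕ → Graph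
Kneser n k = record
  { V   = KSubset n k
  ; Adj = λ u v → Disjoint (Σ.proj₁ u) (Σ.proj₁ v) }
  where open Data.Product

Colourable : Graph → ℕ → ℕ → Set
Colourable G m j =
  Σ (V G → Subset m) λ c →
    ((v : V G) → ∣ c v ∣ ≡ j) ×
    ((u v : V G) → Adj G u v → Disjoint (c u) (c v))

-- "χ_j(G) ≥ b": every m for which G is (m,j)-colourable satisfies b ≤ m.
χ≥ : Graph → ℕ → ℕ → Set
χ≥ G j b = (m : ℕ) → Colourable G m j → b ≤ m

sumL : List ℕ → ℕ
sumL []       = 0
sumL (x ∷ xs) = x + sumL xs

countI₂ : ℕ → List ℕ → ℕ
countI₂ k [] = 0
countI₂ k (x ∷ xs) with x <? k | x <? 2 * k
... | yes _ | _     = countI₂ k xs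
... | no _  | yes _ = suc (countI₂ k xs)
... | no _  | no _  = countI₂ k xs

sumI₃ : (k q r : ℕ) → .{{NonZero k}} → List ℕ → ℕ
sumI₃ k q r [] = 0
sumI₃ k q r (x ∷ xs) with x <? 2 * k
... | yes _ = sumI₃ k q r xs
... | no _  = (q * x ∸ (x * r) / k) + sumI₃ k q r xs

module Submission where

-- Cut [n] into consecutive blocks of sizes n₁, …, n_t. Vertices lying in different blocks
-- are disjoint, hence adjacent, so the colours used inside different blocks are pairwise
-- disjoint and their numbers add up to at most the number of colours. A block with
-- k ≤ nᵢ < 2k contains a vertex, so it uses at least qk − r colours. A block with nᵢ ≥ 2k
-- carries the nᵢ arcs of length k of a cycle through it; by Katona's circle lemma at most k
-- of them share a colour, so double counting gives nᵢ (qk − r) ≤ k · #colours, that is,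
-- at least qnᵢ − ⌊nᵢ r / k⌋ colours.

open import Defs
open import Data.Bool using (Bool; true; false; _∧_; _∨_; not; if_then_else_)
open import Data.Bool.Properties using (¬-not) renaming (_≟_ to _≟ᵇ_)
open import Data.Empty using (⊥; ⊥-elim)
open import Data.Fin using (Fin; zero; suc; toℕ; fromℕ<; punchOut)
open import Data.Fin.Properties
  using (toℕ<n; toℕ-injective; toℕ-fromℕ<; punchOut-injective; any?; ¬Fin0)
import Data.Fin.Properties as Finₚ
open import Data.Fin.Subset using (Subset; _∈_; ∣_∣)
open import Data.Fin.Subset.Properties using (∣p∣≤n)
open import Data.List using (List; []; _∷_; map)
open import Data.List.Relation.Unary.All as All using (All; []; _∷_)
open import Data.List.Relation.Unary.AllPairs using (AllPairs; []; _∷_)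
open import Data.Nat
open import Data.Nat.Properties
open import Data.Nat.DivMod using (m≡m%n+[m/n]*n; m%n<n)
open import Data.Nat.Tactic.RingSolver using (solve-∀)
open import Data.Product using (∃; _×_; _,_; proj₁; proj₂)
open import Data.Sum using (_⊎_; inj₁; inj₂)
open import Data.Vec using ([]; _∷_; lookup; tabulate)
open import Data.Vec.Properties using (lookup⇒[]=; []=⇒lookup; lookup∘tabulate)
open import Function using (_∘_)
open import Relation.Nullary using (¬_; yes; no; does; contradiction)
open import Relation.Nullary.Reflects using (ofʸ; ofⁿ)
open import Relation.Binary.PropositionalEquality
open import Algebra.Properties.CommutativeSemigroup +-commutativeSemigroup using (x∙yz≈y∙xz)
open import Algebra.Properties.Semiring.Sum +-*-semiring
  using (sum; sum-syntax; ∑-comm; ∑-distrib-+; sum-cong-≗; sum-replicate-zero; *-distribˡ-sum)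

indicator : Bool → ℕ
indicator b = if b then 1 else 0

count : ∀ {n} → (Fin n → Bool) → ℕ
count {n} p = ∑[ i < n ] indicator (p i)

∑-mono-≤ : ∀ {n} {f g : Fin n → ℕ} → (∀ i → f i ≤ g i) → sum f ≤ sum g
∑-mono-≤ {zero}  _   = z≤n
∑-mono-≤ {suc n} f≤g = +-mono-≤ (f≤g zero) (∑-mono-≤ (f≤g ∘ suc))

∑-const : ∀ n c → ∑[ i < n ] c ≡ n * c
∑-const zero    c = refl
∑-const (suc n) c = cong (c +_) (∑-const n c)

count-none : ∀ {n} {p : Fin n → Bool} → (∀ i → p i ≡ false) → count p ≡ 0
count-none {n} none = trans (sum-cong-≗ (cong indicator ∘ none)) (sum-replicate-zero n)

count-mono : ∀ {n} {p q : Fin n → Bool} → (∀ i → p i ≡ true → q i ≡ true) → count p ≤ count q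
count-mono {p = p} {q} p⊆q = ∑-mono-≤ indicator-mono
  where
  indicator-mono : ∀ i → indicator (p i) ≤ indicator (q i)
  indicator-mono i with p i | q i | p⊆q i
  ... | false | _     | _   = z≤n
  ... | true  | true  | _   = ≤-refl
  ... | true  | false | p⇒q = contradiction (p⇒q refl) λ ()

count-∨ : ∀ {n} (p q : Fin n → Bool) → (∀ i → p i ≡ true → q i ≡ true → ⊥) →
  count (λ i → p i ∨ q i) ≡ count p + count q
count-∨ p q disjoint = trans (sum-cong-≗ indicator-∨) (∑-distrib-+ (indicator ∘ p) (indicator ∘ q))
  where
  indicator-∨ : ∀ i → indicator (p i ∨ q i) ≡ indicator (p i) + indicator (q i)
  indicator-∨ i with p i | q i | disjoint i
  ... | true  | true  | ¬both = ⊥-elim (¬both refl refl)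
  ... | true  | false | _     = refl
  ... | false | _     | _     = refl

∣p∣≡count : ∀ {n} (p : Subset n) → ∣ p ∣ ≡ count (lookup p)
∣p∣≡count []          = refl
∣p∣≡count (true ∷ p)  = cong suc (∣p∣≡count p)
∣p∣≡count (false ∷ p) = ∣p∣≡count p

∣tabulate∣≡count : ∀ {n} (p : Fin n → Bool) → ∣ tabulate p ∣ ≡ count p
∣tabulate∣≡count p =
  trans (∣p∣≡count (tabulate p)) (sum-cong-≗ (cong indicator ∘ lookup∘tabulate p))

count≤n : ∀ {n} (p : Fin n → Bool) → count p ≤ n
count≤n {n} p = subst (_≤ n) (∣tabulate∣≡count p) (∣p∣≤n (tabulate p))

count≤-injection : ∀ {n k} (p : Fin n → Bool) (φ : ∀ i → p i ≡ true → Fin k) →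
  (∀ i j pi pj → φ i pi ≡ φ j pj → i ≡ j) → count p ≤ k
count≤-injection {zero}     _ _ _ = z≤n
count≤-injection {k = zero} p φ _ = ≤-reflexive (count-none (λ i → ¬-not (¬Fin0 ∘ φ i)))
count≤-injection {suc n} {suc k} p φ φ-inj with p zero in p₀
... | false = count≤-injection (p ∘ suc) (φ ∘ suc)
                (λ i j pi pj → Finₚ.suc-injective ∘ φ-inj (suc i) (suc j) pi pj)
... | true  = s≤s (count≤-injection (p ∘ suc) (λ i pi → punchOut (φ₀≢ i pi))
                (λ i j pi pj → Finₚ.suc-injective ∘ φ-inj (suc i) (suc j) pi pj
                                ∘ punchOut-injective (φ₀≢ i pi) (φ₀≢ j pj)))
  where
  φ₀≢ : ∀ i pi → φ zero p₀ ≢ φ (suc i) pi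
  φ₀≢ i pi = Finₚ.0≢1+n ∘ φ-inj zero (suc i) p₀ pi

least-member : ∀ {n} (p : Fin n → Bool) →
  (∀ i → p i ≡ false) ⊎ ∃ λ i → p i ≡ true × (∀ j → p j ≡ true → toℕ i ≤ toℕ j)
least-member {zero}  p = inj₁ λ ()
least-member {suc n} p with p zero in p₀
... | true  = inj₂ (zero , p₀ , λ _ _ → z≤n)
... | false with least-member (p ∘ suc)
...   | inj₁ none             = inj₁ λ { zero → p₀ ; (suc i) → none i }
...   | inj₂ (i , pi , least) = inj₂ (suc i , pi , λ
          { zero    pj → contradiction (trans (sym p₀) pj) λ ()
          ; (suc j) pj → s≤s (least j pj) })

-- Katona's circle lemma, on starting points: on a cycle of length x the k-arcs starting
-- at s and t are disjoint exactly when s + k ≤ t and t + k ≤ s + x (for s ≤ t).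
katona : ∀ {x} k → 2 * k ≤ x → (p : Fin x → Bool) →
  (∀ s t → p s ≡ true → p t ≡ true → toℕ s + k ≤ toℕ t → toℕ t + k ≤ toℕ s + x → ⊥) →
  count p ≤ k
katona {x} k 2k≤x p intersecting with least-member p
... | inj₁ none = ≤-trans (≤-reflexive (count-none none)) z≤n
... | inj₂ (s , ps , least) = count≤-injection p (λ t pt → fromℕ< (fold<k t pt)) λ t t′ pt pt′ e →
  fold-injective t t′ pt pt′
    (trans (sym (toℕ-fromℕ< (fold<k t pt))) (trans (cong toℕ e) (toℕ-fromℕ< (fold<k t′ pt′))))
  where
  c : ℕ
  c = x ∸ k

  k≤c : k ≤ c
  k≤c = subst (_≤ c) (m+n∸m≡n k k) (∸-monoˡ-≤ k (subst (_≤ x) (cong (k +_) (+-identityʳ k)) 2k≤x))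

  c+k≡x : c + k ≡ x
  c+k≡x = m∸n+n≡m (≤-trans k≤c (m∸n≤m x k))

  offset : Fin x → ℕ
  offset t = toℕ t ∸ toℕ s

  s+offset : ∀ t → p t ≡ true → toℕ s + offset t ≡ toℕ t
  s+offset t pt = m+[n∸m]≡n (least t pt)

  near : ∀ t → p t ≡ true → offset t < k ⊎ c < offset t
  near t pt with offset t <? k | c <? offset t
  ... | yes d<k | _       = inj₁ d<k
  ... | no _    | yes c<d = inj₂ c<d
  ... | no d≮k  | no c≮d  = ⊥-elim (intersecting s t ps pt s+k≤t t+k≤s+x)
    where
    s+k≤t : toℕ s + k ≤ toℕ t
    s+k≤t = subst (toℕ s + k ≤_) (s+offset t pt) (+-monoʳ-≤ (toℕ s) (≮⇒≥ d≮k))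
    t+k≤s+x : toℕ t + k ≤ toℕ s + x
    t+k≤s+x = begin
      toℕ t + k              ≡⟨ cong (_+ k) (s+offset t pt) ⟨
      toℕ s + offset t + k   ≡⟨ +-assoc (toℕ s) (offset t) k ⟩
      toℕ s + (offset t + k) ≤⟨ +-monoʳ-≤ (toℕ s) (+-monoˡ-≤ k (≮⇒≥ c≮d)) ⟩
      toℕ s + (c + k)        ≡⟨ cong (toℕ s +_) c+k≡x ⟩
      toℕ s + x              ∎
      where open ≤-Reasoning

  -- Folding (c, x) onto (0, k) identifies offsets d and d + c only, and members at such
  -- offsets would carry disjoint arcs.
  fold : (d : ℕ) → d < k ⊎ c < d → ℕ
  fold d (inj₁ _) = d
  fold d (inj₂ _) = d ∸ c

  fold-< : ∀ d nd → d < x → fold d nd < k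
  fold-< d (inj₁ d<k) _   = d<k
  fold-< d (inj₂ c<d) d<x =
    +-cancelˡ-< c _ _ (subst₂ _<_ (sym (m+[n∸m]≡n (<⇒≤ c<d))) (sym c+k≡x) d<x)

  fold-collision : ∀ d d′ nd nd′ → fold d nd ≡ fold d′ nd′ →
    d ≡ d′ ⊎ d′ ≡ d + c ⊎ d ≡ d′ + c
  fold-collision d d′ (inj₁ _)   (inj₁ _)    e = inj₁ e
  fold-collision d d′ (inj₂ c<d) (inj₂ c<d′) e = inj₁ (∸-cancelʳ-≡ (<⇒≤ c<d) (<⇒≤ c<d′) e)
  fold-collision d d′ (inj₁ _)   (inj₂ c<d′) e =
    inj₂ (inj₁ (trans (sym (m∸n+n≡m (<⇒≤ c<d′))) (cong (_+ c) (sym e))))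
  fold-collision d d′ (inj₂ c<d) (inj₁ _)    e =
    inj₂ (inj₂ (trans (sym (m∸n+n≡m (<⇒≤ c<d))) (cong (_+ c) e)))

  fold<k : ∀ t pt → fold (offset t) (near t pt) < k
  fold<k t pt = fold-< (offset t) (near t pt) (≤-<-trans (m∸n≤m (toℕ t) (toℕ s)) (toℕ<n t))

  apart : ∀ t t′ → p t ≡ true → p t′ ≡ true → offset t′ ≡ offset t + c → ⊥
  apart t t′ pt pt′ e = intersecting t t′ pt pt′ t+k≤t′ t′+k≤t+x
    where
    t′≡t+c : toℕ t′ ≡ toℕ t + c
    t′≡t+c = begin
      toℕ t′                 ≡⟨ s+offset t′ pt′ ⟨
      toℕ s + offset t′      ≡⟨ cong (toℕ s +_) e ⟩
      toℕ s + (offset t + c) ≡⟨ +-assoc (toℕ s) (offset t) c ⟨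
      toℕ s + offset t + c   ≡⟨ cong (_+ c) (s+offset t pt) ⟩
      toℕ t + c              ∎
      where open ≡-Reasoning
    t+k≤t′ : toℕ t + k ≤ toℕ t′
    t+k≤t′ = subst (toℕ t + k ≤_) (sym t′≡t+c) (+-monoʳ-≤ (toℕ t) k≤c)
    t′+k≤t+x : toℕ t′ + k ≤ toℕ t + x
    t′+k≤t+x = ≤-reflexive
      (trans (cong (_+ k) t′≡t+c) (trans (+-assoc (toℕ t) c k) (cong (toℕ t +_) c+k≡x)))

  fold-injective : ∀ t t′ pt pt′ →
    fold (offset t) (near t pt) ≡ fold (offset t′) (near t′ pt′) → t ≡ t′
  fold-injective t t′ pt pt′ e with fold-collision (offset t) (offset t′) (near t pt) (near t′ pt′) e
  ... | inj₁ same          =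
    toℕ-injective (trans (sym (s+offset t pt)) (trans (cong (toℕ s +_) same) (s+offset t′ pt′)))
  ... | inj₂ (inj₁ t′-far) = ⊥-elim (apart t t′ pt pt′ t′-far)
  ... | inj₂ (inj₂ t-far)  = ⊥-elim (apart t′ t pt′ pt t-far)

ceiling-bound : ∀ {k} .{{_ : NonZero k}} q r x C → r ≤ q * k →
  x * (q * k ∸ r) ≤ k * C → q * x ∸ x * r / k ≤ C
ceiling-bound {k} q r x C r≤qk x[qk∸r]≤kC =
  m≤n+o⇒m∸n≤o (q * x) (x * r / k) (s≤s⁻¹ (*-cancelˡ-< k (q * x) _ k[qx]<k[1+D+C]))
  where
  k[qx]<k[1+D+C] : k * (q * x) < k * suc (x * r / k + C)
  k[qx]<k[1+D+C] = begin-strict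
    k * (q * x)                         ≡⟨ swap k q x ⟩
    x * (q * k)                         ≡⟨ cong (x *_) (m∸n+n≡m r≤qk) ⟨
    x * (q * k ∸ r + r)                 ≡⟨ *-distribˡ-+ x (q * k ∸ r) r ⟩
    x * (q * k ∸ r) + x * r             ≤⟨ +-monoˡ-≤ (x * r) x[qk∸r]≤kC ⟩
    k * C + x * r                       ≡⟨ cong (k * C +_) (m≡m%n+[m/n]*n (x * r) k) ⟩
    k * C + (x * r % k + x * r / k * k) <⟨ +-monoʳ-< (k * C) (+-monoˡ-< _ (m%n<n (x * r) k)) ⟩
    k * C + (k + x * r / k * k)         ≡⟨ regroup k C (x * r / k) ⟩
    k * suc (x * r / k + C)             ∎
    where
    open ≤-Reasoning
    swap : ∀ k q x → k * (q * x) ≡ x * (q * k)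
    swap = solve-∀
    regroup : ∀ k C D → k * C + (k + D * k) ≡ k * suc (D + C)
    regroup = solve-∀

[n∸m]+[o∸n]≡o∸m : ∀ {m n o} → m ≤ n → n ≤ o → (n ∸ m) + (o ∸ n) ≡ o ∸ m
[n∸m]+[o∸n]≡o∸m {m} {n} {o} m≤n n≤o = begin
  (n ∸ m) + (o ∸ n)           ≡⟨ m+n∸m≡n m _ ⟨
  m + ((n ∸ m) + (o ∸ n)) ∸ m ≡⟨ cong (_∸ m) (+-assoc m (n ∸ m) (o ∸ n)) ⟨
  m + (n ∸ m) + (o ∸ n) ∸ m   ≡⟨ cong (λ l → l + (o ∸ n) ∸ m) (m+[n∸m]≡n m≤n) ⟩
  n + (o ∸ n) ∸ m             ≡⟨ cong (_∸ m) (m+[n∸m]≡n n≤o) ⟩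
  o ∸ m                       ∎
  where open ≡-Reasoning

-- Phrased with _<ᵇ_ alone, so that count-interval peels off position 0 by computation.
interval : ℕ → ℕ → ℕ → Bool
interval lo hi z = not (z <ᵇ lo) ∧ (z <ᵇ hi)

interval-sound : ∀ lo hi z → interval lo hi z ≡ true → lo ≤ z × z < hi
interval-sound lo hi z z∈ with z <ᵇ lo | <ᵇ-reflects-< z lo | z <ᵇ hi | <ᵇ-reflects-< z hi
interval-sound _ _ z () | true  | _        | _     | _
interval-sound _ _ z () | false | _        | false | _
interval-sound _ _ z _  | false | ofⁿ z≮lo | true  | ofʸ z<hi = ≮⇒≥ z≮lo , z<hi

count-interval : ∀ {n} lo hi → lo ≤ hi → hi ≤ n →
  count {n} (λ z → interval lo hi (toℕ z)) ≡ hi ∸ lo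
count-interval {n}     zero     zero     _           _          = count-none {n} (λ _ → refl)
count-interval {suc n} zero     (suc hi) _           (s≤s hi≤n) = cong suc (count-interval zero hi z≤n hi≤n)
count-interval {suc n} (suc lo) (suc hi) (s≤s lo≤hi) (s≤s hi≤n) = count-interval lo hi lo≤hi hi≤n

-- The k-arc with offset s on the cycle a, a + 1, …, a + x − 1 of positions of a block;
-- its part beyond a + x wraps around to a.
arc : (k a x s : ℕ) → ℕ → Bool
arc k a x s z = interval (a + s) (a + (s + k) ⊓ x) z ∨ interval a (a + (s + k ∸ x)) z

arc-sound : ∀ {k a x s} z → arc k a x s z ≡ true →
  (a + s ≤ z × z < a + (s + k) ⊓ x) ⊎ (a ≤ z × z < a + (s + k ∸ x))
arc-sound {k} {a} {x} {s} z z∈ with interval (a + s) (a + (s + k) ⊓ x) z in unwrapped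
... | true  = inj₁ (interval-sound (a + s) (a + (s + k) ⊓ x) z unwrapped)
... | false = inj₂ (interval-sound a (a + (s + k ∸ x)) z z∈)

wrapped≤offset : ∀ {k x} s → k ≤ x → s + k ∸ x ≤ s
wrapped≤offset {k} s k≤x = ≤-trans (∸-monoʳ-≤ (s + k) k≤x) (≤-reflexive (m+n∸n≡m s k))

arc-within : ∀ {k a x s} z → k ≤ x → s ≤ x → arc k a x s z ≡ true → a ≤ z × z < a + x
arc-within {k} {a} {x} {s} z k≤x s≤x z∈ with arc-sound {k} {a} {x} {s} z z∈
... | inj₁ (a+s≤z , z<end) =
  ≤-trans (m≤m+n a s) a+s≤z , <-≤-trans z<end (+-monoʳ-≤ a (m⊓n≤n (s + k) x))
... | inj₂ (a≤z , z<end)   =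
  a≤z , <-≤-trans z<end (+-monoʳ-≤ a (≤-trans (wrapped≤offset s k≤x) s≤x))

arc-length : ∀ k x s → s ≤ x → (s + k) ⊓ x ∸ s + (s + k ∸ x) ≡ k
arc-length k x s s≤x with s + k ≤? x
... | yes s+k≤x = begin
  (s + k) ⊓ x ∸ s + (s + k ∸ x)
    ≡⟨ cong₂ (λ u v → u ∸ s + v) (m≤n⇒m⊓n≡m s+k≤x) (m≤n⇒m∸n≡0 s+k≤x) ⟩
  s + k ∸ s + 0                 ≡⟨ +-identityʳ _ ⟩
  s + k ∸ s                     ≡⟨ m+n∸m≡n s k ⟩
  k                             ∎
  where open ≡-Reasoning
... | no s+k≰x = begin
  (s + k) ⊓ x ∸ s + (s + k ∸ x) ≡⟨ cong (λ u → u ∸ s + (s + k ∸ x)) (m≥n⇒m⊓n≡n x≤s+k) ⟩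
  x ∸ s + (s + k ∸ x)           ≡⟨ [n∸m]+[o∸n]≡o∸m s≤x x≤s+k ⟩
  s + k ∸ s                     ≡⟨ m+n∸m≡n s k ⟩
  k                             ∎
  where
  open ≡-Reasoning
  x≤s+k : x ≤ s + k
  x≤s+k = <⇒≤ (≰⇒> s+k≰x)

count-arc : ∀ {n k a x s} → a + x ≤ n → k ≤ x → s ≤ x →
  count {n} (λ z → arc k a x s (toℕ z)) ≡ k
count-arc {n} {k} {a} {x} {s} a+x≤n k≤x s≤x = begin
  count {n} (λ z → arc k a x s (toℕ z))
    ≡⟨ count-∨ (λ z → interval (a + s) end (toℕ z)) (λ z → interval a wrapEnd (toℕ z))
               pieces-disjoint ⟩
  count {n} (λ z → interval (a + s) end (toℕ z)) + count {n} (λ z → interval a wrapEnd (toℕ z))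
    ≡⟨ cong₂ _+_ (count-interval (a + s) end (+-monoʳ-≤ a (⊓-glb (m≤m+n s k) s≤x))
                                 (≤-trans (+-monoʳ-≤ a (m⊓n≤n (s + k) x)) a+x≤n))
                 (count-interval a wrapEnd (m≤m+n a _)
                                 (≤-trans (+-monoʳ-≤ a (≤-trans (wrapped≤offset s k≤x) s≤x)) a+x≤n)) ⟩
  end ∸ (a + s) + (wrapEnd ∸ a)
    ≡⟨ cong₂ _+_ ([m+n]∸[m+o]≡n∸o a ((s + k) ⊓ x) s) (m+n∸m≡n a _) ⟩
  (s + k) ⊓ x ∸ s + (s + k ∸ x)
    ≡⟨ arc-length k x s s≤x ⟩
  k ∎
  where
  open ≡-Reasoning
  end wrapEnd : ℕ
  end = a + (s + k) ⊓ x
  wrapEnd = a + (s + k ∸ x)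
  pieces-disjoint : ∀ (z : Fin n) → interval (a + s) end (toℕ z) ≡ true →
    interval a wrapEnd (toℕ z) ≡ true → ⊥
  pieces-disjoint z z∈₁ z∈₂ = <-irrefl refl (≤-<-trans (proj₁ (interval-sound (a + s) end (toℕ z) z∈₁))
    (<-≤-trans (proj₂ (interval-sound a wrapEnd (toℕ z) z∈₂)) (+-monoʳ-≤ a (wrapped≤offset s k≤x))))

arc-disjoint : ∀ {k a x s t} z → t ≤ x → s + k ≤ t → t + k ≤ s + x →
  arc k a x s z ≡ true → arc k a x t z ≡ true → ⊥
arc-disjoint {k} {a} {x} {s} {t} z t≤x s+k≤t t+k≤s+x z∈s z∈t with arc-sound {k} {a} {x} {s} z z∈s
... | inj₂ (a≤z , z<a+wrap) =
  <-irrefl refl (≤-<-trans a≤z (<-≤-trans z<a+wrap (≤-reflexive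
    (trans (cong (a +_) (m≤n⇒m∸n≡0 (≤-trans s+k≤t t≤x))) (+-identityʳ a)))))
... | inj₁ (a+s≤z , z<end) with arc-sound {k} {a} {x} {t} z z∈t
...   | inj₁ (a+t≤z , _) =
  <-irrefl refl (<-≤-trans z<end (≤-trans (+-monoʳ-≤ a (≤-trans (m⊓n≤m (s + k) x) s+k≤t)) a+t≤z))
...   | inj₂ (_ , z<a+wrap) =
  <-irrefl refl (≤-<-trans a+s≤z (<-≤-trans z<a+wrap (+-monoʳ-≤ a
    (≤-trans (∸-monoˡ-≤ x t+k≤s+x) (≤-reflexive (m+n∸n≡m s x))))))

record Family (G : Graph) : Set where
  constructor family
  field
    size   : ℕ
    member : Fin size → V G

CrossAdjacent : ∀ {G} → Family G → Family G → Set
CrossAdjacent {G} (family _ F) (family _ F′) = ∀ s t → Adj G (F s) (F′ t)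

module ProperColouring {G : Graph} {m : ℕ} (c : V G → Subset m)
  (proper : ∀ u v → Adj G u v → Disjoint (c u) (c v)) where

  colours : Family G → Fin m → Bool
  colours (family _ F) y = does (any? λ t → lookup (c (F t)) y ≟ᵇ true)

  colours-intro : ∀ {x} (F : Fin x → V G) t y → lookup (c (F t)) y ≡ true →
    colours (family x F) y ≡ true
  colours-intro F t y y∈ with any? (λ t → lookup (c (F t)) y ≟ᵇ true)
  ... | yes _ = refl
  ... | no ∄  = contradiction (t , y∈) ∄

  colours-elim : ∀ {x} (F : Fin x → V G) y → colours (family x F) y ≡ true →
    ∃ λ t → lookup (c (F t)) y ≡ true
  colours-elim F y y∈ with any? (λ t → lookup (c (F t)) y ≟ᵇ true)
  ... | yes ∃t = ∃t

  shared-colour⇒¬adjacent : ∀ u v y → lookup (c u) y ≡ true → lookup (c v) y ≡ true → ¬ Adj G u v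
  shared-colour⇒¬adjacent u v y y∈u y∈v adj =
    proper u v adj y (lookup⇒[]= y (c u) y∈u) (lookup⇒[]= y (c v) y∈v)

  colours-disjoint : ∀ F F′ → CrossAdjacent F F′ → ∀ y →
    colours F y ≡ true → colours F′ y ≡ true → ⊥
  colours-disjoint (family _ F) (family _ F′) adj y y∈F y∈F′
    with colours-elim F y y∈F | colours-elim F′ y y∈F′
  ... | s , y∈s | t , y∈t = shared-colour⇒¬adjacent (F s) (F′ t) y y∈s y∈t (adj s t)

  allColours : List (Family G) → Fin m → Bool
  allColours []       y = false
  allColours (F ∷ Fs) y = colours F y ∨ allColours Fs y

  colours-disjoint-all : ∀ {F} Fs → All (CrossAdjacent F) Fs → ∀ y →
    colours F y ≡ true → allColours Fs y ≡ true → ⊥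
  colours-disjoint-all {F} (F′ ∷ Fs) (adj ∷ adjs) y y∈F y∈Fs with colours F′ y in y∈F′
  ... | true  = colours-disjoint F F′ adj y y∈F y∈F′
  ... | false = colours-disjoint-all Fs adjs y y∈F y∈Fs

  count-allColours : ∀ Fs → AllPairs CrossAdjacent Fs →
    sumL (map (count ∘ colours) Fs) ≡ count (allColours Fs)
  count-allColours []       []             = sym (count-none {m} (λ _ → refl))
  count-allColours (F ∷ Fs) (adjs ∷ pairs) =
    trans (cong (count (colours F) +_) (count-allColours Fs pairs))
          (sym (count-∨ (colours F) (allColours Fs) (colours-disjoint-all Fs adjs)))

  colour-budget : ∀ Fs → AllPairs CrossAdjacent Fs → sumL (map (count ∘ colours) Fs) ≤ m
  colour-budget Fs pairs = subst (_≤ m) (sym (count-allColours Fs pairs)) (count≤n (allColours Fs))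

  module _ {j} (∣c∣≡j : ∀ v → ∣ c v ∣ ≡ j) where

    j≡count : ∀ v → j ≡ count (lookup (c v))
    j≡count v = trans (sym (∣c∣≡j v)) (∣p∣≡count (c v))

    member-bound : ∀ {x} (F : Fin x → V G) → Fin x → j ≤ count (colours (family x F))
    member-bound F t = subst (_≤ _) (sym (j≡count (F t))) (count-mono (colours-intro F t))

    double-count : ∀ {x k} (F : Fin x → V G) → (∀ y → count (λ t → lookup (c (F t)) y) ≤ k) →
      x * j ≤ k * count (colours (family x F))
    double-count {x} {k} F class≤k = begin
      x * j                                                 ≡⟨ ∑-const x j ⟨
      ∑[ t < x ] j                                          ≡⟨ sum-cong-≗ (j≡count ∘ F) ⟩
      ∑[ t < x ] ∑[ y < m ] incidence t y                   ≡⟨ ∑-comm incidence ⟩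
      ∑[ y < m ] count (λ t → lookup (c (F t)) y)           ≤⟨ ∑-mono-≤ class≤used ⟩
      ∑[ y < m ] (k * indicator (colours (family x F) y))
        ≡⟨ *-distribˡ-sum k (indicator ∘ colours (family x F)) ⟨
      k * count (colours (family x F))                      ∎
      where
      open ≤-Reasoning
      incidence : Fin x → Fin m → ℕ
      incidence t y = indicator (lookup (c (F t)) y)
      class≤used : ∀ y → count (λ t → lookup (c (F t)) y) ≤ k * indicator (colours (family x F) y)
      class≤used y with colours (family x F) y in used
      ... | true  = subst (_ ≤_) (sym (*-identityʳ k)) (class≤k y)
      ... | false = ≤-reflexive (trans (count-none unused) (sym (*-zeroʳ k)))
        where
        unused : ∀ t → lookup (c (F t)) y ≡ false
        unused t = ¬-not λ y∈t → contradiction (trans (sym (colours-intro F t y y∈t)) used) λ ()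

Within : ∀ {n} → ℕ → ℕ → Subset n → Set
Within lo hi p = ∀ z → z ∈ p → lo ≤ toℕ z × toℕ z < hi

module KneserBlocks (n k : ℕ) where

  FamilyWithin : ℕ → ℕ → Family (Kneser n k) → Set
  FamilyWithin lo hi (family _ F) = ∀ t → Within lo hi (proj₁ (F t))

  within-weaken : ∀ {lo lo′ hi hi′} F → lo ≤ lo′ → hi′ ≤ hi →
    FamilyWithin lo′ hi′ F → FamilyWithin lo hi F
  within-weaken _ lo≤lo′ hi′≤hi within t z z∈ =
    let lo′≤z , z<hi′ = within t z z∈ in ≤-trans lo≤lo′ lo′≤z , <-≤-trans z<hi′ hi′≤hi

  within-cross : ∀ {lo mid hi} F F′ → FamilyWithin lo mid F → FamilyWithin mid hi F′ →
    CrossAdjacent F F′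
  within-cross _ _ F-within F′-within s t z z∈s z∈t =
    <-irrefl refl (<-≤-trans (proj₂ (F-within s z z∈s)) (proj₁ (F′-within t z z∈t)))

  arcs : ∀ a x → a + x ≤ n → k ≤ x → Fin x → KSubset n k
  arcs a x a+x≤n k≤x s =
    tabulate (arc k a x (toℕ s) ∘ toℕ) ,
    trans (∣tabulate∣≡count {n} (arc k a x (toℕ s) ∘ toℕ))
          (count-arc {n} {k} {a} {x} {toℕ s} a+x≤n k≤x (<⇒≤ (toℕ<n s)))

  ∈-arcs : ∀ {a x a+x≤n k≤x} s z → z ∈ proj₁ (arcs a x a+x≤n k≤x s) →
    arc k a x (toℕ s) (toℕ z) ≡ true
  ∈-arcs {a} {x} s z z∈ = trans (sym (lookup∘tabulate (arc k a x (toℕ s) ∘ toℕ) z)) ([]=⇒lookup z∈)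

  arcs-within : ∀ a x a+x≤n k≤x → FamilyWithin a (a + x) (family x (arcs a x a+x≤n k≤x))
  arcs-within a x a+x≤n k≤x s z z∈ =
    arc-within {k} {a} {x} (toℕ z) k≤x (<⇒≤ (toℕ<n s)) (∈-arcs {a} {x} {a+x≤n} {k≤x} s z z∈)

  arcs-disjoint : ∀ a x a+x≤n k≤x (s t : Fin x) → toℕ s + k ≤ toℕ t → toℕ t + k ≤ toℕ s + x →
    Disjoint (proj₁ (arcs a x a+x≤n k≤x s)) (proj₁ (arcs a x a+x≤n k≤x t))
  arcs-disjoint a x a+x≤n k≤x s t s+k≤t t+k≤s+x z z∈s z∈t =
    arc-disjoint {k} {a} {x} (toℕ z) (<⇒≤ (toℕ<n t)) s+k≤t t+k≤s+x
      (∈-arcs {a} {x} {a+x≤n} {k≤x} s z z∈s) (∈-arcs {a} {x} {a+x≤n} {k≤x} t z z∈t)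

  block : ∀ a x → a + x ≤ n → Family (Kneser n k)
  block a x a+x≤n with x <? k
  ... | yes _  = family 0 λ ()
  ... | no x≮k = family x (arcs a x a+x≤n (≮⇒≥ x≮k))

  block-within : ∀ a x a+x≤n → FamilyWithin a (a + x) (block a x a+x≤n)
  block-within a x a+x≤n with x <? k
  ... | yes _  = λ ()
  ... | no x≮k = arcs-within a x a+x≤n (≮⇒≥ x≮k)

  head-fits : ∀ a x xs → a + sumL (x ∷ xs) ≤ n → a + x ≤ n
  head-fits a x xs fits = ≤-trans (+-monoʳ-≤ a (m≤m+n x (sumL xs))) fits

  tail-fits : ∀ a x xs → a + sumL (x ∷ xs) ≤ n → a + x + sumL xs ≤ n
  tail-fits a x xs fits = subst (_≤ n) (sym (+-assoc a x (sumL xs))) fits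

  blocks : ∀ a xs → a + sumL xs ≤ n → List (Family (Kneser n k))
  blocks a []       _    = []
  blocks a (x ∷ xs) fits = block a x (head-fits a x xs fits) ∷ blocks (a + x) xs (tail-fits a x xs fits)

  blocks-within : ∀ a xs fits → All (FamilyWithin a n) (blocks a xs fits)
  blocks-within a []       _    = []
  blocks-within a (x ∷ xs) fits =
    within-weaken (block a x _) ≤-refl (head-fits a x xs fits) (block-within a x _) ∷
    All.map (λ {F} → within-weaken F (m≤m+n a x) ≤-refl) (blocks-within (a + x) xs (tail-fits a x xs fits))

  blocks-cross : ∀ a xs fits → AllPairs CrossAdjacent (blocks a xs fits)
  blocks-cross a []       _    = []
  blocks-cross a (x ∷ xs) fits =
    All.map (λ {F} → within-cross (block a x _) F (block-within a x _))
            (blocks-within (a + x) xs (tail-fits a x xs fits)) ∷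
    blocks-cross (a + x) xs (tail-fits a x xs fits)

module Contribution (k q r : ℕ) .{{_ : NonZero k}} where

  contribution : ℕ → ℕ
  contribution x with x <? k | x <? 2 * k
  ... | yes _ | _     = 0
  ... | no _  | yes _ = q * k ∸ r
  ... | no _  | no _  = q * x ∸ x * r / k

  lower-bound≡∑contribution : ∀ xs →
    countI₂ k xs * (q * k ∸ r) + sumI₃ k q r xs ≡ sumL (map contribution xs)
  lower-bound≡∑contribution []       = refl
  lower-bound≡∑contribution (x ∷ xs) with x <? k | x <? 2 * k
  ... | yes _   | yes _   = lower-bound≡∑contribution xs
  ... | yes x<k | no x≮2k = contradiction (<-≤-trans x<k (m≤m+n k (k + 0))) x≮2k
  ... | no _    | yes _   =
    trans (+-assoc (q * k ∸ r) _ _) (cong (q * k ∸ r +_) (lower-bound≡∑contribution xs))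
  ... | no _    | no _    =
    trans (x∙yz≈y∙xz (countI₂ k xs * (q * k ∸ r)) (q * x ∸ x * r / k) _)
          (cong (q * x ∸ x * r / k +_) (lower-bound≡∑contribution xs))

module KneserColouringBound {n k m q r : ℕ} .{{_ : NonZero k}} (r≤qk : r ≤ q * k)
  (c : KSubset n k → Subset m) (∣c∣≡j : ∀ v → ∣ c v ∣ ≡ q * k ∸ r)
  (proper : ∀ u v → Disjoint (proj₁ u) (proj₁ v) → Disjoint (c u) (c v)) where

  open KneserBlocks n k public
  open ProperColouring {Kneser n k} c proper public
  open Contribution k q r public

  colour-class≤k : ∀ a x a+x≤n k≤x → 2 * k ≤ x → ∀ y →
    count (λ t → lookup (c (arcs a x a+x≤n k≤x t)) y) ≤ k
  colour-class≤k a x a+x≤n k≤x 2k≤x y = katona k 2k≤x _ λ s t y∈s y∈t s+k≤t t+k≤s+x →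
    shared-colour⇒¬adjacent _ _ y y∈s y∈t (arcs-disjoint a x a+x≤n k≤x s t s+k≤t t+k≤s+x)

  block-bound : ∀ a x a+x≤n → contribution x ≤ count (colours (block a x a+x≤n))
  block-bound a x a+x≤n with x <? k | x <? 2 * k
  ... | yes _  | _       = z≤n
  ... | no x≮k | yes _   = member-bound ∣c∣≡j (arcs a x a+x≤n k≤x) (fromℕ< (<-≤-trans (>-nonZero⁻¹ k) k≤x))
    where k≤x = ≮⇒≥ x≮k
  ... | no x≮k | no x≮2k = ceiling-bound q r x _ r≤qk
    (double-count ∣c∣≡j (arcs a x a+x≤n k≤x) (colour-class≤k a x a+x≤n k≤x (≮⇒≥ x≮2k)))
    where k≤x = ≮⇒≥ x≮k

  contributions≤colours : ∀ a xs fits →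
    sumL (map contribution xs) ≤ sumL (map (count ∘ colours) (blocks a xs fits))
  contributions≤colours a []       _    = z≤n
  contributions≤colours a (x ∷ xs) fits =
    +-mono-≤ (block-bound a x _) (contributions≤colours (a + x) xs _)

lemma3p2 : (n k r q : ℕ) → .{{_ : NonZero k}} → 2 * k ≤ n → 1 ≤ q → r + 1 ≤ k →
    (ns : List ℕ) → All (λ x → 1 ≤ x) ns → sumL ns ≡ n →
    χ≥ (Kneser n k) (q * k ∸ r) (countI₂ k ns * (q * k ∸ r) + sumI₃ k q r ns)
lemma3p2 n k r q _ 1≤q r+1≤k ns _ ∑ns≡n m (c , ∣c∣≡j , proper) = begin
  countI₂ k ns * (q * k ∸ r) + sumI₃ k q r ns      ≡⟨ lower-bound≡∑contribution ns ⟩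
  sumL (map contribution ns)                       ≤⟨ contributions≤colours 0 ns fits ⟩
  sumL (map (count ∘ colours) (blocks 0 ns fits))  ≤⟨ colour-budget _ (blocks-cross 0 ns fits) ⟩
  m                                                ∎
  where
  open ≤-Reasoning
  r≤qk : r ≤ q * k
  r≤qk = ≤-trans (≤-trans (m≤m+n r 1) r+1≤k)
                 (≤-trans (≤-reflexive (sym (*-identityˡ k))) (*-monoˡ-≤ k 1≤q))
  fits : sumL ns ≤ n
  fits = ≤-reflexive ∑ns≡n
  open KneserColouringBound {q = q} r≤qk c ∣c∣≡j proper
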